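{- For $i\in\{0,1,2,3\}$ let $S_i$ be a $3$-star with center $u_i$ and leaves $a_i,b_i,c_i$, and let $Z$ be the tree of order $13$ obtained from the disjoint union of $S_0,\dots,S_3$ by identifying $c_0$ with $c_1$, $a_0$ with $c_2$, and $a_1$ with $c_3$. Then $\gamma^{\rm ID}(Z)=8<\frac23|V(Z)|$.
   Context: An identifying code of a graph $G$ is a set $C\subseteq V(G)$ such that every vertex $v$ satisfies $N[v]\cap C\neq\emptyset$ and distinct vertices $u,v$ satisfy $N[u]\cap C\neq N[v]\cap C$, where $N[v]$ is the closed neighborhood; $\gamma^{\rm ID}(G)$ is its minimum size. -}

module Defs where

open import Data.Nat using (ℕ; _*_; _<_; _≤_)
open import Data.Fin using (Fin; #_)
open import Data.Fin.Subset using (Subset; _∈_; _∩_; ∣_∣)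
open import Data.Product using (_×_; Σ; ∃; _,_)
open import Data.Sum using (_⊎_; inj₁; inj₂)
open import Data.List using (List; []; _∷_)
open import Data.List.Relation.Unary.Any using (here; there)
open import Data.List.Membership.Propositional using () renaming (_∈_ to _∈ₗ_)
open import Relation.Binary.PropositionalEquality using (_≡_; _≢_)
open import Relation.Nullary using (¬_)

record Graph (n : ℕ) : Set₁ where
  field
    Adj     : Fin n → Fin n → Set
    sym     : ∀ {x y} → Adj x y → Adj y x
    irrefl  : ∀ {x} → ¬ Adj x x

open Graph public

InN[_,_] : ∀ {n} → Graph n → Fin n → Fin n → Set
InN[ G , v ] u = (u ≡ v) ⊎ Adj G v u

IsIdentifyingCode : ∀ {n} → Graph n → Subset n → Set
IsIdentifyingCode {n} G C =
  (∀ v → ∃ λ w → w ∈ C × InN[ G , v ] w) ×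
  (∀ u v → u ≢ v → ¬ (∀ w → w ∈ C → (InN[ G , u ] w → InN[ G , v ] w) × (InN[ G , v ] w → InN[ G , u ] w)))

IDNumberIs : ∀ {n} → Graph n → ℕ → Set
IDNumberIs {n} G k =
  (Σ (Subset n) λ C → IsIdentifyingCode G C × ∣ C ∣ ≡ k) ×
  (∀ C → IsIdentifyingCode G C → k ≤ ∣ C ∣)

-- The tree Z of order 13.  Vertex labelling:
--  0 = u0, 1 = u1, 2 = u2, 3 = u3,
--  4 = a0 (= c2), 5 = b0, 6 = c0 (= c1), 7 = a1 (= c3), 8 = b1,
--  9 = a2, 10 = b2, 11 = a3, 12 = b3.
ZEdges : List (Fin 13 × Fin 13)
ZEdges =
  (# 0 , # 4) ∷ (# 0 , # 5) ∷ (# 0 , # 6) ∷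
  (# 1 , # 6) ∷ (# 1 , # 7) ∷ (# 1 , # 8) ∷
  (# 2 , # 9) ∷ (# 2 , # 10) ∷ (# 2 , # 4) ∷
  (# 3 , # 11) ∷ (# 3 , # 12) ∷ (# 3 , # 7) ∷ []

ZAdj : Fin 13 → Fin 13 → Set
ZAdj x y = ((x , y) ∈ₗ ZEdges) ⊎ ((y , x) ∈ₗ ZEdges)

ZAdj-sym : ∀ {x y} → ZAdj x y → ZAdj y x
ZAdj-sym (inj₁ p) = inj₂ p
ZAdj-sym (inj₂ p) = inj₁ p

private
  noLoop : ∀ {x : Fin 13} → ¬ ((x , x) ∈ₗ ZEdges)
  noLoop (here ())
  noLoop (there (here ()))
  noLoop (there (there (here ())))
  noLoop (there (there (there (here ()))))
  noLoop (there (there (there (there (here ())))))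
  noLoop (there (there (there (there (there (here ()))))))
  noLoop (there (there (there (there (there (there (here ())))))))
  noLoop (there (there (there (there (there (there (there (here ()))))))))
  noLoop (there (there (there (there (there (there (there (there (here ())))))))))
  noLoop (there (there (there (there (there (there (there (there (there (here ()))))))))))
  noLoop (there (there (there (there (there (there (there (there (there (there (here ())))))))))))
  noLoop (there (there (there (there (there (there (there (there (there (there (there (here ()))))))))))))
  noLoop (there (there (there (there (there (there (there (there (there (there (there (there ()))))))))))))

ZAdj-irrefl : ∀ {x} → ¬ ZAdj x x
ZAdj-irrefl (inj₁ p) = noLoop p
ZAdj-irrefl (inj₂ p) = noLoop p

Z : Graph 13
Z = record { Adj = ZAdj ; sym = ZAdj-sym ; irrefl = ZAdj-irrefl }

{-# OPTIONS --safe #-}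
-- An identifying code C meets every closed neighbourhood N[v] and every symmetric difference
-- N[u] △ N[v] with u ≠ v, and thirteen of these sets already force eight elements.  The disjoint
-- groups {2,9,10} and {3,11,12} need two elements each (N[9], N[10], N[9] △ N[10] = {9,10} and
-- likewise), and {0,5} = N[5], {1,8} = N[8], {4,6} = N[0] △ N[5] one each.  If moreover 7 ∉ C,
-- then N[3] △ N[11] = {7,12} and N[3] △ N[12] = {7,11} put 11 and 12 in C, while N[7] = {1,3,7}
-- and N[7] △ N[8] = {3,7,8} give 3 ∈ C or 1, 8 ∈ C: an eighth element either way.  The code
-- {0,1,2,3,4,7,9,11} attains the bound.  Only the final count over these thirteen small sets is
-- left to exhaustive search; searching all subsets for identifying codes directly is far too slow.
module Submission where

open import Defs
open import Data.Nat using (_*_; _<_; _≤_)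
open import Data.Nat.Properties using (_<?_; ≮⇒≥)
open import Data.Fin using (Fin; #_; _≟_)
open import Data.Fin.Properties using (all?; any?)
open import Data.Fin.Subset using (Subset; inside; outside; _∈_; ∣_∣)
open import Data.Fin.Subset.Properties using (_∈?_; anySubset?)
open import Data.Product using (_×_; _,_; ∃)
open import Data.Product.Properties using (≡-dec)
open import Data.Vec using ([]; _∷_)
open import Data.List using (List; []; _∷_)
open import Data.List.Relation.Unary.Any as Any using (Any)
open import Data.List.Relation.Unary.All as All using (All; []; _∷_)
open import Data.List.Membership.Propositional using (lose) renaming (_∈_ to _∈ₗ_)
open import Data.List.Membership.DecPropositional (_≟_ {13}) using () renaming (_∈?_ to _∈ₗ?_)
open import Data.List.Membership.DecPropositional (≡-dec (_≟_ {13}) (_≟_ {13})) using () renaming (_∈?_ to _∈ₑ?_)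
open import Relation.Binary.PropositionalEquality using (refl; _≢_)
open import Relation.Nullary using (Dec; ¬_)
open import Relation.Nullary.Decidable
  using (True; False; toWitness; toWitnessFalse; from-yes; from-no; decidable-stable; _⊎-dec_; _×-dec_; _→-dec_; ¬?)

Meets : ∀ {n} → Subset n → List (Fin n) → Set
Meets C = Any (_∈ C)

AgreeAt : ∀ {n} → Graph n → Fin n → Fin n → Fin n → Set
AgreeAt G u v w = (InN[ G , u ] w → InN[ G , v ] w) × (InN[ G , v ] w → InN[ G , u ] w)

Separates : ∀ {n} → Graph n → Fin n → Fin n → Fin n → Set
Separates G u v w = ¬ AgreeAt G u v w

code-meets-closedNbhd : ∀ {n} (G : Graph n) {C} → IsIdentifyingCode G C →
                        ∀ v {L} → (∀ w → InN[ G , v ] w → w ∈ₗ L) → Meets C L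
code-meets-closedNbhd G (dominating , _) v N[v]⊆L
  with w , w∈C , w∈N[v] ← dominating v = lose (N[v]⊆L w w∈N[v]) w∈C

module _ {n} (G : Graph n) (adj? : ∀ x y → Dec (Adj G x y)) where

  inN? : ∀ v w → Dec (InN[ G , v ] w)
  inN? v w = (w ≟ v) ⊎-dec adj? v w

  agreeAt? : ∀ u v w → Dec (AgreeAt G u v w)
  agreeAt? u v w = (inN? u w →-dec inN? v w) ×-dec (inN? v w →-dec inN? u w)

  separates? : ∀ u v w → Dec (Separates G u v w)
  separates? u v w = ¬? (agreeAt? u v w)

  isIdentifyingCode? : ∀ C → Dec (IsIdentifyingCode G C)
  isIdentifyingCode? C =
    all? (λ v → any? λ w → (w ∈? C) ×-dec inN? v w) ×-dec
    all? (λ u → all? λ v → ¬? (u ≟ v) →-dec ¬? (all? λ w → (w ∈? C) →-dec agreeAt? u v w))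

  code-meets-separator : ∀ {C} → IsIdentifyingCode G C →
                         ∀ {u v L} → u ≢ v → (∀ w → Separates G u v w → w ∈ₗ L) → Meets C L
  code-meets-separator {C} (_ , separating) {u} {v} {L} u≢v Δ⊆L =
    decidable-stable (Any.any? (_∈? C) L) λ ¬meets →
      separating u v u≢v λ w w∈C →
        decidable-stable (agreeAt? u v w) λ sep → ¬meets (lose (Δ⊆L w sep) w∈C)

ZAdj? : ∀ x y → Dec (ZAdj x y)
ZAdj? x y = ((x , y) ∈ₑ? ZEdges) ⊎-dec ((y , x) ∈ₑ? ZEdges)

ZClauses : List (List (Fin 13))
ZClauses =
  (# 0 ∷ # 5 ∷ []) ∷ (# 1 ∷ # 8 ∷ []) ∷
  (# 2 ∷ # 9 ∷ []) ∷ (# 2 ∷ # 10 ∷ []) ∷ (# 3 ∷ # 11 ∷ []) ∷ (# 3 ∷ # 12 ∷ []) ∷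
  (# 1 ∷ # 3 ∷ # 7 ∷ []) ∷
  (# 9 ∷ # 10 ∷ []) ∷ (# 11 ∷ # 12 ∷ []) ∷
  (# 4 ∷ # 6 ∷ []) ∷ (# 3 ∷ # 7 ∷ # 8 ∷ []) ∷ (# 7 ∷ # 12 ∷ []) ∷ (# 7 ∷ # 11 ∷ []) ∷ []

code-meets-ZClauses : ∀ {C} → IsIdentifyingCode Z C → All (Meets C) ZClauses
code-meets-ZClauses {C} code =
  closedNbhd (# 5) ∷ closedNbhd (# 8) ∷
  closedNbhd (# 9) ∷ closedNbhd (# 10) ∷ closedNbhd (# 11) ∷ closedNbhd (# 12) ∷
  closedNbhd (# 7) ∷
  separator (# 9) (# 10) ∷ separator (# 11) (# 12) ∷
  separator (# 0) (# 5) ∷ separator (# 7) (# 8) ∷ separator (# 3) (# 11) ∷ separator (# 3) (# 12) ∷ []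
  where
  closedNbhd : ∀ v {L} {N[v]⊆L : True (all? λ w → inN? Z ZAdj? v w →-dec w ∈ₗ? L)} → Meets C L
  closedNbhd v {_} {N[v]⊆L} = code-meets-closedNbhd Z code v (toWitness N[v]⊆L)

  separator : ∀ u v {L} {u≢v : False (u ≟ v)}
              {Δ⊆L : True (all? λ w → separates? Z ZAdj? u v w →-dec w ∈ₗ? L)} → Meets C L
  separator u v {_} {u≢v} {Δ⊆L} = code-meets-separator Z ZAdj? code (toWitnessFalse u≢v) (toWitness Δ⊆L)

meets-ZClauses⇒8≤∣C∣ : ∀ C → All (Meets C) ZClauses → 8 ≤ ∣ C ∣
meets-ZClauses⇒8≤∣C∣ C meets = ≮⇒≥ λ ∣C∣<8 → noSmallHittingSet (C , ∣C∣<8 , meets)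
  where
  noSmallHittingSet : ¬ ∃ λ C → ∣ C ∣ < 8 × All (Meets C) ZClauses
  noSmallHittingSet =
    from-no (anySubset? λ C → (∣ C ∣ <? 8) ×-dec All.all? (Any.any? (_∈? C)) ZClauses)

ZCode : Subset 13
ZCode = inside ∷ inside ∷ inside ∷ inside ∷ inside ∷ outside ∷ outside ∷
        inside ∷ outside ∷ inside ∷ outside ∷ inside ∷ outside ∷ []

ZCode-isIdentifyingCode : IsIdentifyingCode Z ZCode
ZCode-isIdentifyingCode = from-yes (isIdentifyingCode? Z ZAdj? ZCode)

lemma4p16 : IDNumberIs Z 8 × (3 * 8 < 2 * 13)
lemma4p16 = ((ZCode , ZCode-isIdentifyingCode , refl) , lowerBound) , from-yes (3 * 8 <? 2 * 13)
  where
  lowerBound : ∀ C → IsIdentifyingCode Z C → 8 ≤ ∣ C ∣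
  lowerBound C code = meets-ZClauses⇒8≤∣C∣ C (code-meets-ZClauses code)
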